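{- Let $\mathfrak C$ be a category and $\alpha:a\to a'$ a $\mathfrak C$-arrow. Then $\alpha$ is amalgamable in $\mathfrak C$ if and only if $\alpha$ is an amalgamable object of the arrow extension $\vec{\mathfrak C}$. Hence, identifying $\mathfrak C$ with the full subcategory of $\vec{\mathfrak C}$ on the objects $(a,\mathrm{id}_a)$, the full subcategory of $\vec{\mathfrak C}$ on the objects of $\mathfrak C$ together with all amalgamable objects of $\vec{\mathfrak C}$ is an amalgamation extension of $\mathfrak C$.
   Context: Composition $g\circ f$ ($f$ first). The arrow extension $\vec{\mathfrak C}$ of $\mathfrak C$: its objects are the $\mathfrak C$-arrows $\alpha:a\to a'$ (written $(a,\alpha)$); a $\vec{\mathfrak C}$-arrow $(a,\alpha)\to(b,\beta)$ is a $\mathfrak C$-arrow $f:a\to b$ such that $f=f'\circ\alpha$ for some $\mathfrak C$-arrow $f'$, or $f=\mathrm{id}_a$ when $\alpha=\beta$; composition is that of $\mathfrak C$. The functor $a\mapsto(a,\mathrm{id}_a)$ identifies $\mathfrak C$ with a full cofinal subcategory of $\vec{\mathfrak C}$. An arrow $e:z\to z'$ is amalgamable if for all $f:z'\to x$, $g:z'\to y$ there are $f':x\to w$, $g':y\to w$ with $f'\circ f\circ e=g'\circ g\circ e$; an object is amalgamable if its identity is. A subcategory $\mathfrak C\subseteq\mathfrak C'$ is cofinal if every $\mathfrak C'$-object has an arrow into a $\mathfrak C$-object. $\mathfrak C'\supseteq\mathfrak C$ is an amalgamation extension of $\mathfrak C$ if $\mathfrak C$ is full and cofinal in $\mathfrak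 C'$, every $\mathfrak C'$-object not in $\mathfrak C$ is amalgamable in $\mathfrak C'$, and every amalgamable $\mathfrak C$-arrow factorizes through an amalgamable $\mathfrak C'$-object. -}

module Defs where

open import Level using (Level; _⊔_) renaming (suc to lsuc)
open import Data.Product using (Σ; Σ-syntax; _×_; _,_; proj₁; proj₂)
open import Data.Sum using (_⊎_; inj₁; inj₂)
open import Relation.Nullary using (¬_)
open import Relation.Binary.Structures using (IsEquivalence)
open import Relation.Binary.PropositionalEquality using (_≡_; refl; subst; cong)

-- Categorical data: objects, hom-sets with an equality of arrows (a setoid;
-- take _≈_ = _≡_ for an ordinary category), identities and composition
-- g ∘ f  ("f first").
record CatData (o h e : Level) : Set (lsuc (o ⊔ h ⊔ e)) where
  infixr 9 _∘_
  infix 4 _≈_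
  field
    Obj : Set o
    Hom : Obj → Obj → Set h
    _≈_ : ∀ {a b} → Hom a b → Hom a b → Set e
    id  : ∀ {a} → Hom a a
    _∘_ : ∀ {a b c} → Hom b c → Hom a b → Hom a c

record Category (o h e : Level) : Set (lsuc (o ⊔ h ⊔ e)) where
  field
    catData : CatData o h e
  open CatData catData public
  field
    ≈-equiv   : ∀ {a b} → IsEquivalence (_≈_ {a} {b})
    assoc     : ∀ {a b c d} {f : Hom a b} {g : Hom b c} {k : Hom c d} →
                (k ∘ g) ∘ f ≈ k ∘ (g ∘ f)
    identityˡ : ∀ {a b} {f : Hom a b} → id ∘ f ≈ f
    identityʳ : ∀ {a b} {f : Hom a b} → f ∘ id ≈ f
    ∘-resp-≈  : ∀ {a b c} {f f' : Hom a b} {g g' : Hom b c} →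
                g ≈ g' → f ≈ f' → g ∘ f ≈ g' ∘ f'

module _ {o h e : Level} (D : CatData o h e) where
  open CatData D

  AmalgArrow : ∀ {z z'} → Hom z z' → Set (o ⊔ h ⊔ e)
  AmalgArrow {z} {z'} ε =
    ∀ {x y} (f : Hom z' x) (g : Hom z' y) →
    Σ[ w ∈ Obj ] Σ[ f' ∈ Hom x w ] Σ[ g' ∈ Hom y w ]
      (f' ∘ (f ∘ ε) ≈ g' ∘ (g ∘ ε))

  AmalgObj : Obj → Set (o ⊔ h ⊔ e)
  AmalgObj z = AmalgArrow (id {z})

FullSub : ∀ {o h e p} (D : CatData o h e) → (CatData.Obj D → Set p) →
          CatData (o ⊔ p) h e
FullSub D P = record
  { Obj = Σ Obj P
  ; Hom = λ x y → Hom (proj₁ x) (proj₁ y)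
  ; _≈_ = _≈_
  ; id  = id
  ; _∘_ = _∘_
  }
  where open CatData D

-- "C' ⊇ C is an amalgamation extension of C", where C is identified with
-- a subcategory of C' through the embedding (E , EH).
record IsAmalgamationExtension {o h e o' h' e'}
         (C : CatData o h e) (C' : CatData o' h' e')
         (E : CatData.Obj C → CatData.Obj C')
         (EH : ∀ {a b} → CatData.Hom C a b → CatData.Hom C' (E a) (E b))
         : Set (o ⊔ h ⊔ e ⊔ o' ⊔ h' ⊔ e') where
  private
    module C  = CatData C
    module C' = CatData C'
  field
    E-injective : ∀ {a b} → E a ≡ E b → a ≡ b
    EH-faithful : ∀ {a b} {f g : C.Hom a b} → EH f C'.≈ EH g → f C.≈ g
    EH-id       : ∀ {a} → EH (C.id {a}) C'.≈ C'.id
    EH-∘        : ∀ {a b c} {f : C.Hom a b} {g : C.Hom b c} →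
                  EH (g C.∘ f) C'.≈ (EH g C'.∘ EH f)
    full        : ∀ {a b} (k : C'.Hom (E a) (E b)) →
                  Σ[ f ∈ C.Hom a b ] (EH f C'.≈ k)
    cofinal     : ∀ (x : C'.Obj) → Σ[ a ∈ C.Obj ] C'.Hom x (E a)
    outside-amalg : ∀ (x : C'.Obj) → ¬ (Σ[ a ∈ C.Obj ] x ≡ E a) →
                    AmalgObj C' x
    factorize   : ∀ {z z'} (ε : C.Hom z z') → AmalgArrow C ε →
                  Σ[ w ∈ C'.Obj ] AmalgObj C' w ×
                  (Σ[ u ∈ C'.Hom (E z) w ] Σ[ v ∈ C'.Hom w (E z') ]
                     (v C'.∘ u C'.≈ EH ε))

module ArrowExtension {o h e : Level} (C : Category o h e) where
  open Category C

  private
    module Eq {a b} = IsEquivalence (≈-equiv {a} {b})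

  record ArrObj : Set (o ⊔ h) where
    constructor arr
    field
      src : Obj
      tgt : Obj
      mor : Hom src tgt
  open ArrObj public

  ArrCond : (x y : ArrObj) → Hom (src x) (src y) → Set (o ⊔ h ⊔ e)
  ArrCond x y f =
    (Σ[ f' ∈ Hom (tgt x) (src y) ] (f ≈ f' ∘ mor x)) ⊎
    (Σ[ p ∈ x ≡ y ] (f ≈ subst (Hom (src x)) (cong src p) id))

  id-cond : ∀ {x} → ArrCond x x id
  id-cond = inj₂ (refl , Eq.refl)

  ∘-cond : ∀ {x y z} (g : Hom (src y) (src z)) (f : Hom (src x) (src y)) →
           ArrCond y z g → ArrCond x y f → ArrCond x z (g ∘ f)
  ∘-cond g f cg (inj₁ (f' , p)) =
    inj₁ (g ∘ f' , Eq.trans (∘-resp-≈ Eq.refl p) (Eq.sym assoc))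
  ∘-cond g f (inj₁ (g' , r)) (inj₂ (refl , p)) =
    inj₁ (g' , Eq.trans (Eq.trans (∘-resp-≈ Eq.refl p) identityʳ) r)
  ∘-cond g f (inj₂ (s , r)) (inj₂ (refl , p)) =
    inj₂ (s , Eq.trans (Eq.trans (∘-resp-≈ Eq.refl p) identityʳ) r)

  ArrowExt : CatData (o ⊔ h) (o ⊔ h ⊔ e) e
  ArrowExt = record
    { Obj = ArrObj
    ; Hom = λ x y → Σ[ f ∈ Hom (src x) (src y) ] ArrCond x y f
    ; _≈_ = λ f g → proj₁ f ≈ proj₁ g
    ; id  = id , id-cond
    ; _∘_ = λ g f → (proj₁ g ∘ proj₁ f) , ∘-cond (proj₁ g) (proj₁ f) (proj₂ g) (proj₂ f)
    }

  IsCObj : ArrObj → Set (o ⊔ h)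
  IsCObj x = Σ[ a ∈ Obj ] x ≡ arr a a id

  AmalgSub : CatData (o ⊔ h ⊔ e) (o ⊔ h ⊔ e) e
  AmalgSub = FullSub ArrowExt (λ x → IsCObj x ⊎ AmalgObj ArrowExt x)

  embObj : Obj → CatData.Obj AmalgSub
  embObj a = arr a a id , inj₁ (a , refl)

  embHom : ∀ {a b} → Hom a b → CatData.Hom AmalgSub (embObj a) (embObj b)
  embHom f = f , inj₁ (f , Eq.sym identityʳ)

module Submission where

open import Defs
open import Level using (Level; _⊔_)
open import Data.Product using (_×_; Σ-syntax; _,_; proj₁; proj₂)
open import Data.Sum using (_⊎_; inj₁; inj₂)
open import Data.Empty using (⊥-elim)
open import Relation.Nullary using (¬_)
open import Function.Bundles using (_⇔_; mk⇔)
open import Relation.Binary.Bundles using (Setoid)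
open import Relation.Binary.Structures using (IsEquivalence)
open import Relation.Binary.PropositionalEquality using (_≡_; refl; cong)
import Relation.Binary.Reasoning.Setoid as SetoidReasoning

-- A →C-arrow f : (a , α) → (x , ξ) satisfies ξ ∘ f = F ∘ α for some F, and
-- ξ itself is a →C-arrow (x , ξ) → (x' , id).  Hence an amalgamation of F, G
-- along α in C amalgamates (a , α) in →C over a C-object; conversely the
-- C-arrows f ∘ α are →C-arrows out of (a , α).  Postcomposing with ξ also
-- moves any amalgamation in →C onto a C-object, so amalgamable objects of →C
-- stay amalgamable in the full subcategory, and (a , α) itself factors α as
-- (a , id) → (a , α) → (a' , id).

module _ {o h e : Level} (C : Category o h e) where
  open Category C
  open ArrowExtension C

  private
    module Eq {a b} = IsEquivalence (≈-equiv {a} {b})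
    hom-setoid : Obj → Obj → Setoid h e
    hom-setoid a b = record { isEquivalence = ≈-equiv {a} {b} }
    module ≈-Reasoning {a b} = SetoidReasoning (hom-setoid a b)
    module →C = CatData ArrowExt

  idArr : Obj → ArrObj
  idArr a = arr a a id

  precompose-mor : ∀ {x : ArrObj} {b} (f : Hom (tgt x) b) → →C.Hom x (idArr b)
  precompose-mor {x} f = f ∘ mor x , inj₁ (f , Eq.refl)

  mor-∘-factors : ∀ {a a'} {α : Hom a a'} {x : ArrObj} (f : →C.Hom (arr a a' α) x) →
                  Σ[ F ∈ Hom a' (tgt x) ] (mor x ∘ proj₁ f ≈ F ∘ α)
  mor-∘-factors {α = α} {x} (f , inj₁ (f' , f≈f'∘α)) = mor x ∘ f' , (begin
    mor x ∘ f          ≈⟨ ∘-resp-≈ Eq.refl f≈f'∘α ⟩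
    mor x ∘ (f' ∘ α)   ≈⟨ Eq.sym assoc ⟩
    (mor x ∘ f') ∘ α   ∎)
    where open ≈-Reasoning
  mor-∘-factors {α = α} (f , inj₂ (refl , f≈id)) = id , (begin
    α ∘ f    ≈⟨ ∘-resp-≈ Eq.refl f≈id ⟩
    α ∘ id   ≈⟨ identityʳ ⟩
    α        ≈⟨ Eq.sym identityˡ ⟩
    id ∘ α   ∎)
    where open ≈-Reasoning

  amalgArrow⇒amalgObj : ∀ {a a'} (α : Hom a a') →
                        AmalgArrow catData α → AmalgObj ArrowExt (arr a a' α)
  amalgArrow⇒amalgObj α amalg {x} {y} f g
    with mor-∘-factors f | mor-∘-factors g
  ... | F , mor∘f≈F∘α | G , mor∘g≈G∘α with amalg F G
  ... | w , f' , g' , amalgamates =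
    idArr w , precompose-mor f' , precompose-mor g' , (begin
      (f' ∘ mor x) ∘ (proj₁ f ∘ id)   ≈⟨ ∘-resp-≈ Eq.refl identityʳ ⟩
      (f' ∘ mor x) ∘ proj₁ f          ≈⟨ assoc ⟩
      f' ∘ (mor x ∘ proj₁ f)          ≈⟨ ∘-resp-≈ Eq.refl mor∘f≈F∘α ⟩
      f' ∘ (F ∘ α)                    ≈⟨ amalgamates ⟩
      g' ∘ (G ∘ α)                    ≈⟨ ∘-resp-≈ Eq.refl (Eq.sym mor∘g≈G∘α) ⟩
      g' ∘ (mor y ∘ proj₁ g)          ≈⟨ Eq.sym assoc ⟩
      (g' ∘ mor y) ∘ proj₁ g          ≈⟨ ∘-resp-≈ Eq.refl (Eq.sym identityʳ) ⟩
      (g' ∘ mor y) ∘ (proj₁ g ∘ id)   ∎)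
    where open ≈-Reasoning

  -- The objects of →C are passed explicitly throughout: its hom-sets mention
  -- them only through ArrCond, from which Agda cannot recover them.
  amalgObj⇒amalgArrow : ∀ {a a'} (α : Hom a a') →
                        AmalgObj ArrowExt (arr a a' α) → AmalgArrow catData α
  amalgObj⇒amalgArrow α amalg f g
    with amalg {idArr _} {idArr _} (f ∘ α , inj₁ (f , Eq.refl)) (g ∘ α , inj₁ (g , Eq.refl))
  ... | w , f' , g' , amalgamates = src w , proj₁ f' , proj₁ g' , (begin
    proj₁ f' ∘ (f ∘ α)          ≈⟨ ∘-resp-≈ Eq.refl (Eq.sym identityʳ) ⟩
    proj₁ f' ∘ ((f ∘ α) ∘ id)   ≈⟨ amalgamates ⟩
    proj₁ g' ∘ ((g ∘ α) ∘ id)   ≈⟨ ∘-resp-≈ Eq.refl identityʳ ⟩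
    proj₁ g' ∘ (g ∘ α)          ∎)
    where open ≈-Reasoning

  amalgArrow⇔amalgObj : ∀ {a a'} (α : Hom a a') →
                        AmalgArrow catData α ⇔ AmalgObj ArrowExt (arr a a' α)
  amalgArrow⇔amalgObj α = mk⇔ (amalgArrow⇒amalgObj α) (amalgObj⇒amalgArrow α)

  amalgObj-fullSub : ∀ {p} (P : ArrObj → Set p) → (∀ a → P (idArr a)) →
                     ∀ {x} (px : P x) → AmalgObj ArrowExt x →
                     AmalgObj (FullSub ArrowExt P) (x , px)
  amalgObj-fullSub P P-idArr _ amalg {x'} {y'} f g with amalg {proj₁ x'} {proj₁ y'} f g
  ... | w , f' , g' , amalgamates =
    (idArr (tgt w) , P-idArr (tgt w)) , k →C.∘ f' , k →C.∘ g' , (begin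
      ((id ∘ mor w) ∘ proj₁ f') ∘ (proj₁ f ∘ id)   ≈⟨ assoc ⟩
      (id ∘ mor w) ∘ proj₁ f' ∘ (proj₁ f ∘ id)     ≈⟨ ∘-resp-≈ Eq.refl amalgamates ⟩
      (id ∘ mor w) ∘ proj₁ g' ∘ (proj₁ g ∘ id)     ≈⟨ Eq.sym assoc ⟩
      ((id ∘ mor w) ∘ proj₁ g') ∘ (proj₁ g ∘ id)   ∎)
    where
    open ≈-Reasoning
    k = precompose-mor {w} id

  private
    module Sub = CatData AmalgSub

  amalgObj⇒amalgSub : ∀ {x} (amalg : AmalgObj ArrowExt x) →
                      AmalgObj AmalgSub (x , inj₂ amalg)
  amalgObj⇒amalgSub {x} amalg {x'} {y'} =
    amalgObj-fullSub (λ y → IsCObj y ⊎ AmalgObj ArrowExt y) (λ a → inj₁ (a , refl))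
                     {x} (inj₂ amalg) amalg {x'} {y'}

  amalgSub-outside-amalg : (x : Sub.Obj) → ¬ (Σ[ a ∈ Obj ] x ≡ embObj a) →
                           AmalgObj AmalgSub x
  amalgSub-outside-amalg (.(idArr a) , inj₁ (a , refl)) x∉C = ⊥-elim (x∉C (a , refl))
  amalgSub-outside-amalg (x , inj₂ amalg) _ {x'} {y'} = amalgObj⇒amalgSub {x} amalg {x'} {y'}

  amalgSub-factorize : ∀ {z z'} (ε : Hom z z') → AmalgArrow catData ε →
                       Σ[ w ∈ Sub.Obj ] AmalgObj AmalgSub w ×
                       (Σ[ u ∈ Sub.Hom (embObj z) w ] Σ[ v ∈ Sub.Hom w (embObj z') ]
                          (proj₁ v ∘ proj₁ u ≈ ε))
  amalgSub-factorize {z} {z'} ε amalg =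
    (arr z z' ε , inj₂ amalg→C) , (λ {x'} {y'} → amalgObj⇒amalgSub amalg→C {x'} {y'}) ,
    (id , inj₁ (id , Eq.sym identityʳ)) , precompose-mor {arr z z' ε} id ,
    Eq.trans identityʳ identityˡ
    where
    amalg→C : AmalgObj ArrowExt (arr z z' ε)
    amalg→C = amalgArrow⇒amalgObj ε amalg

  amalgSub-isAmalgamationExtension :
    IsAmalgamationExtension catData AmalgSub embObj embHom
  amalgSub-isAmalgamationExtension = record
    { E-injective   = cong (λ x → src (proj₁ x))
    ; EH-faithful   = λ f≈g → f≈g
    ; EH-id         = Eq.refl
    ; EH-∘          = Eq.refl
    ; full          = λ k → proj₁ k , Eq.refl
    ; cofinal       = λ x → tgt (proj₁ x) , precompose-mor {proj₁ x} id
    ; outside-amalg = amalgSub-outside-amalg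
    ; factorize     = amalgSub-factorize
    }

mainTheorem8 : ∀ {o h e} (C : Category o h e) →
    let open Category C
        open ArrowExtension C
    in (∀ {a a'} (α : Hom a a') →
          AmalgArrow catData α ⇔ AmalgObj ArrowExt (arr a a' α))
       × IsAmalgamationExtension catData AmalgSub embObj embHom
mainTheorem8 C = amalgArrow⇔amalgObj C , amalgSub-isAmalgamationExtension C
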